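{- Any finite simple graph $G$ containing neighbourhood chains of Type 3 (as defined below) is non-distance magic.
   Context: $N(u)=\{v: uv\in E(G)\}$. A bijection $f:V(G)\to\{1,\dots,|V(G)|\}$ is a distance magic labeling if $\sum_{v\in N(u)}f(v)$ is constant over $u\in V(G)$; $G$ is non-distance magic if it has no such labeling. A neighbourhood chain of length $k\ge2$ is a sequence $N_1\cdots N_k$ with $N_i=N(u_i)$, $u_i\in V(G)$, such that $N_i\cap N_{i+1}\ne\emptyset$ for $1\le i\le k-1$ and $N_i\cap N_j=\emptyset$ whenever $|i-j|\ge2$ and $\{i,j\}\ne\{1,k\}$. Type 3 chains: Let $n_1,n_2\ge2$, $n_3\ge\max\{n_1,n_2\}+3$. For $k=1,2,3$ let $V_k=\{u^k_1,\dots,u^k_{n_k}\}\subseteq V(G)$, pairwise disjoint, with $V_1$ and $V_2$ stable sets. For $j=1,2$ and $1\le i\le n_j$ let $N^j_i=N(u^j_i)\subseteq V_3$, $N^j_i\ne\emptyset$, and suppose $NC_j=N^j_1\cdots N^j_{n_j}$ is a neighbourhood chain for $j=1,2$. $NC_1,NC_2$ are Type 3 chains if (i) for $j=1,2$: $N^j_{i+1}\setminus N^j_i\subseteq N^j_{i+2}$ for $i=1,\dots,n_j-2$, and $|N^j_i\setminus N^j_{i+1}|\ge1$, $|N^j_{i+1}\setminus N^j_i|\ge1$ for $i=1,\dots,n_j-1$; (ii) with $q=\min\{n_1,n_2\}$ there exist $1\le i\le n_1-1$, $1\le j\le n_2-1$, $0\le r\le\lfloor q/2\rfloor-1$ with $N^2_j\setminus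 N^2_{j+1}\subseteq N^1_i\setminus N^1_{i+1}$, $N^1_{i+1+2r}\setminus N^1_{i+2r}\subseteq N^2_{j+1+2r}\setminus N^2_{j+2r}$, and $|(N^1_i\setminus N^1_{i+1})\setminus(N^2_j\setminus N^2_{j+1})|+|(N^2_{j+1+2r}\setminus N^2_{j+2r})\setminus(N^1_{i+1+2r}\setminus N^1_{i+2r})|\ge1$. -}

module Defs where

open import Data.Nat using (ℕ; zero; suc; _+_; _*_; _∸_; _≤_; _/_; ∣_-_∣)
open import Data.Nat.Base using (_⊓_)
open import Data.Fin using (Fin; toℕ)
open import Data.Fin.Subset using (Subset; _∈_; _∉_; _⊆_; _∩_; _─_; ∣_∣; Nonempty; Empty)
open import Data.Vec using (lookup; tabulate; sum)
open import Data.Bool using (if_then_else_)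
open import Data.Product using (Σ; ∃; _×_; _,_)
open import Data.Sum using (_⊎_)
open import Relation.Nullary using (¬_)
open import Relation.Binary.PropositionalEquality using (_≡_; _≢_)
open import Function.Definitions using (Bijective)

record Graph : Set where
  field
    n      : ℕ
    N      : Fin n → Subset n
    irrefl : ∀ u → u ∉ N u
    sym    : ∀ u v → v ∈ N u → u ∈ N v
open Graph public

-- Weight of u under a labeling f (label of v is 1 + toℕ (f v) ∈ {1,…,n}):
-- sum of the labels of the neighbours of u.
weight : (G : Graph) → (Fin (n G) → Fin (n G)) → Fin (n G) → ℕ
weight G f u = sum (tabulate λ v → if lookup (N G u) v then suc (toℕ (f v)) else 0)

IsDistanceMagicLabeling : (G : Graph) → (Fin (n G) → Fin (n G)) → Set
IsDistanceMagicLabeling G f =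
  Bijective _≡_ _≡_ f × Σ ℕ λ k → ∀ u → weight G f u ≡ k

NonDistanceMagic : Graph → Set
NonDistanceMagic G = ¬ (Σ (Fin (n G) → Fin (n G)) λ f → IsDistanceMagicLabeling G f)

NbhdChain : (G : Graph) → (k : ℕ) → (ℕ → Fin (n G)) → Set
NbhdChain G k w =
  2 ≤ k
  × (∀ i → 1 ≤ i → i + 1 ≤ k → Nonempty (N G (w i) ∩ N G (w (suc i))))
  × (∀ i j → 1 ≤ i → i ≤ k → 1 ≤ j → j ≤ k → 2 ≤ ∣ i - j ∣
       → ¬ ((i ≡ 1 × j ≡ k) ⊎ (i ≡ k × j ≡ 1))
       → Empty (N G (w i) ∩ N G (w j)))

InjectiveOn : {A : Set} → ℕ → (ℕ → A) → Set
InjectiveOn m u = ∀ i j → 1 ≤ i → i ≤ m → 1 ≤ j → j ≤ m → u i ≡ u j → i ≡ j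

DisjointOn : {A : Set} → ℕ → (ℕ → A) → ℕ → (ℕ → A) → Set
DisjointOn m u m' u' = ∀ i j → 1 ≤ i → i ≤ m → 1 ≤ j → j ≤ m' → u i ≢ u' j

StableOn : (G : Graph) → ℕ → (ℕ → Fin (n G)) → Set
StableOn G m u = ∀ i j → 1 ≤ i → i ≤ m → 1 ≤ j → j ≤ m → u j ∉ N G (u i)

InOn : {A : Set} → ℕ → (ℕ → A) → A → Set
InOn m u v = ∃ λ i → 1 ≤ i × i ≤ m × u i ≡ v

CondI : (G : Graph) → ℕ → (ℕ → Fin (n G)) → Set
CondI G m u =
  (∀ i → 1 ≤ i → i ≤ m ∸ 2 → (N G (u (i + 1)) ─ N G (u i)) ⊆ N G (u (i + 2)))
  × (∀ i → 1 ≤ i → i ≤ m ∸ 1 →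
       1 ≤ ∣ N G (u i) ─ N G (u (i + 1)) ∣ × 1 ≤ ∣ N G (u (i + 1)) ─ N G (u i) ∣)

record Type3Chains (G : Graph) : Set where
  field
    n₁ n₂ n₃ : ℕ
    u₁ u₂ u₃ : ℕ → Fin (n G)
    n₁≥2 : 2 ≤ n₁
    n₂≥2 : 2 ≤ n₂
    n₃≥  : n₁ + 3 ≤ n₃ × n₂ + 3 ≤ n₃
    inj₁ : InjectiveOn n₁ u₁
    inj₂ : InjectiveOn n₂ u₂
    inj₃ : InjectiveOn n₃ u₃
    disj₁₂ : DisjointOn n₁ u₁ n₂ u₂
    disj₁₃ : DisjointOn n₁ u₁ n₃ u₃
    disj₂₃ : DisjointOn n₂ u₂ n₃ u₃
    stable₁ : StableOn G n₁ u₁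
    stable₂ : StableOn G n₂ u₂
    N₁⊆V₃ : ∀ i → 1 ≤ i → i ≤ n₁ → ∀ v → v ∈ N G (u₁ i) → InOn n₃ u₃ v
    N₂⊆V₃ : ∀ i → 1 ≤ i → i ≤ n₂ → ∀ v → v ∈ N G (u₂ i) → InOn n₃ u₃ v
    N₁≠∅ : ∀ i → 1 ≤ i → i ≤ n₁ → Nonempty (N G (u₁ i))
    N₂≠∅ : ∀ i → 1 ≤ i → i ≤ n₂ → Nonempty (N G (u₂ i))
    chain₁ : NbhdChain G n₁ u₁
    chain₂ : NbhdChain G n₂ u₂
    condI₁ : CondI G n₁ u₁
    condI₂ : CondI G n₂ u₂
    -- condition (ii); the index bounds i+1+2r ≤ n₁, j+1+2r ≤ n₂ make the
    -- sets N¹_{i+1+2r}, N²_{j+1+2r} be among the chain's sets.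
    condII : Σ ℕ λ i → Σ ℕ λ j → Σ ℕ λ r →
      1 ≤ i × i ≤ n₁ ∸ 1 × 1 ≤ j × j ≤ n₂ ∸ 1 × r ≤ (n₁ ⊓ n₂) / 2 ∸ 1
      × i + 1 + 2 * r ≤ n₁ × j + 1 + 2 * r ≤ n₂
      × (N G (u₂ j) ─ N G (u₂ (j + 1))) ⊆ (N G (u₁ i) ─ N G (u₁ (i + 1)))
      × (N G (u₁ (i + 1 + 2 * r)) ─ N G (u₁ (i + 2 * r)))
          ⊆ (N G (u₂ (j + 1 + 2 * r)) ─ N G (u₂ (j + 2 * r)))
      × 1 ≤ ∣ (N G (u₁ i) ─ N G (u₁ (i + 1))) ─ (N G (u₂ j) ─ N G (u₂ (j + 1))) ∣
            + ∣ (N G (u₂ (j + 1 + 2 * r)) ─ N G (u₂ (j + 2 * r)))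
                ─ (N G (u₁ (i + 1 + 2 * r)) ─ N G (u₁ (i + 2 * r))) ∣

{-# OPTIONS --safe #-}
module Submission where

open import Defs hiding (sym)
open import Data.Nat using (ℕ; suc; _+_; _*_; _∸_; _≤_; _<_; s≤s; z≤n; ∣_-_∣)
open import Data.Nat.Properties
open import Data.Fin using (Fin; toℕ) renaming (zero to fzero; suc to fsuc)
open import Data.Fin.Subset using (Subset; _⊆_; _∩_; _─_; ∣_∣; Empty)
open import Data.Fin.Subset.Properties
  using (⊆-antisym; p∩q⊆q; x∈p∩q⁺; x∈p∩q⁻; p─q⊆p; x∈p∧x∉q⇒x∈p─q; ∩-comm)
open import Data.Vec using ([]; _∷_; lookup; tabulate; sum)
open import Data.Bool using (true; false; if_then_else_; _∧_)
open import Data.Product using (_×_; _,_; proj₁; proj₂)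
open import Data.Sum using (_⊎_; inj₁; inj₂)
open import Function using (_∘_)
open import Relation.Nullary using (¬_)
open import Relation.Binary.PropositionalEquality
  using (_≡_; refl; sym; trans; cong; subst; subst₂; module ≡-Reasoning)
open import Algebra.Properties.CommutativeSemigroup +-commutativeSemigroup
  using (x∙yz≈y∙xz; xy∙z≈xz∙y)
open import Data.Nat.Tactic.RingSolver using (solve-∀)

-- Along a chain N₁ ⋯ N_L of neighbourhoods of constant weight k, write A_i = N_i ∖ N_{i+1}
-- and B_i = N_{i+1} ∖ N_i.  Equal weights of N_i and N_{i+1} give w(A_i) = w(B_i).  Condition
-- (i) and the chain's disjointness make N_{i+1} ∩ N_{i+2} = B_i, so k = w(B_i) + w(B_{i+1}),
-- whence w(B_i) = w(B_{i+2}) and w(A_i) = w(B_{i+2r}).  Condition (ii) nests these sets for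
-- the two chains: A²_j ⊆ A¹_i and B¹_{i+2r} ⊆ B²_{j+2r}, with w(A¹_i) = w(B¹_{i+2r}) and
-- w(A²_j) = w(B²_{j+2r}).  Hence both differences have weight 0, i.e. are empty since every
-- label is positive, against the strictness in (ii).

weightOf : ∀ {m} → (Fin m → ℕ) → Subset m → ℕ
weightOf g S = sum (tabulate λ v → if lookup S v then g v else 0)

weightOf-∩-─ : ∀ {m} (g : Fin m → ℕ) S T →
               weightOf g S ≡ weightOf g (S ∩ T) + weightOf g (S ─ T)
weightOf-∩-─ g [] [] = refl
weightOf-∩-─ g (true ∷ S) (true ∷ T) =
  trans (cong (g fzero +_) (weightOf-∩-─ (g ∘ fsuc) S T)) (sym (+-assoc (g fzero) _ _))
weightOf-∩-─ g (true ∷ S) (false ∷ T) =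
  trans (cong (g fzero +_) (weightOf-∩-─ (g ∘ fsuc) S T))
        (x∙yz≈y∙xz (g fzero) (weightOf (g ∘ fsuc) (S ∩ T)) _)
weightOf-∩-─ g (false ∷ S) (true ∷ T)  = weightOf-∩-─ (g ∘ fsuc) S T
weightOf-∩-─ g (false ∷ S) (false ∷ T) = weightOf-∩-─ (g ∘ fsuc) S T

∣∣≤weightOf : ∀ {m} (g : Fin m → ℕ) → (∀ v → 1 ≤ g v) → ∀ S → ∣ S ∣ ≤ weightOf g S
∣∣≤weightOf g pos []          = z≤n
∣∣≤weightOf g pos (true ∷ S)  = +-mono-≤ (pos fzero) (∣∣≤weightOf (g ∘ fsuc) (pos ∘ fsuc) S)
∣∣≤weightOf g pos (false ∷ S) = ∣∣≤weightOf (g ∘ fsuc) (pos ∘ fsuc) S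

⊆⇒∩≡ : ∀ {m} {S T : Subset m} → S ⊆ T → T ∩ S ≡ S
⊆⇒∩≡ {S = S} {T} S⊆T = ⊆-antisym (p∩q⊆q T S) (λ x∈S → x∈p∩q⁺ (S⊆T x∈S , x∈S))

─⊆⇒∩≡─ : ∀ {m} {P Q R : Subset m} → Q ─ P ⊆ R → Empty (P ∩ R) → R ∩ Q ≡ Q ─ P
─⊆⇒∩≡─ {P = P} {Q} {R} Q─P⊆R P∩R≡∅ = ⊆-antisym
  (λ x∈R∩Q → let x∈R , x∈Q = x∈p∩q⁻ R Q x∈R∩Q in
     x∈p∧x∉q⇒x∈p─q x∈Q (λ x∈P → P∩R≡∅ (_ , x∈p∩q⁺ (x∈P , x∈R))))
  (λ x∈Q─P → x∈p∩q⁺ (Q─P⊆R x∈Q─P , p─q⊆p Q P x∈Q─P))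

module _ {m : ℕ} (g : Fin m → ℕ) where

  private
    w : Subset m → ℕ
    w = weightOf g

  weightOf-─-swap : ∀ P Q → w P ≡ w Q → w (P ─ Q) ≡ w (Q ─ P)
  weightOf-─-swap P Q wP≡wQ = +-cancelˡ-≡ (w (P ∩ Q)) _ _ (begin
    w (P ∩ Q) + w (P ─ Q) ≡⟨ weightOf-∩-─ g P Q ⟨
    w P                   ≡⟨ wP≡wQ ⟩
    w Q                   ≡⟨ weightOf-∩-─ g Q P ⟩
    w (Q ∩ P) + w (Q ─ P) ≡⟨ cong (λ X → w X + w (Q ─ P)) (∩-comm Q P) ⟩
    w (P ∩ Q) + w (Q ─ P) ∎)
    where open ≡-Reasoning

  weightOf-⊆ : ∀ {S T} → S ⊆ T → w T ≡ w S + w (T ─ S)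
  weightOf-⊆ {S} {T} S⊆T = trans (weightOf-∩-─ g T S) (cong (λ X → w X + w (T ─ S)) (⊆⇒∩≡ S⊆T))

  weightOf≡gain+gain : ∀ {P Q R} → Q ─ P ⊆ R → Empty (P ∩ R) → w R ≡ w (Q ─ P) + w (R ─ Q)
  weightOf≡gain+gain {P} {Q} {R} Q─P⊆R P∩R≡∅ =
    trans (weightOf-∩-─ g R Q) (cong (λ X → w X + w (R ─ Q)) (─⊆⇒∩≡─ Q─P⊆R P∩R≡∅))

  weightOf-gain-periodic : ∀ {S₀ S₁ S₂ S₃} →
    S₁ ─ S₀ ⊆ S₂ → Empty (S₀ ∩ S₂) → S₂ ─ S₁ ⊆ S₃ → Empty (S₁ ∩ S₃) → w S₂ ≡ w S₃ →
    w (S₁ ─ S₀) ≡ w (S₃ ─ S₂)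
  weightOf-gain-periodic {S₀} {S₁} {S₂} {S₃} grow₀ apart₀ grow₁ apart₁ w₂≡w₃ =
    +-cancelʳ-≡ (w (S₂ ─ S₁)) _ _ (begin
      w (S₁ ─ S₀) + w (S₂ ─ S₁) ≡⟨ weightOf≡gain+gain grow₀ apart₀ ⟨
      w S₂                      ≡⟨ w₂≡w₃ ⟩
      w S₃                      ≡⟨ weightOf≡gain+gain grow₁ apart₁ ⟩
      w (S₂ ─ S₁) + w (S₃ ─ S₂) ≡⟨ +-comm (w (S₂ ─ S₁)) _ ⟩
      w (S₃ ─ S₂) + w (S₂ ─ S₁) ∎)
    where open ≡-Reasoning

  nested-balanced⇒weightOf─≡0 : ∀ {A₁ A₂ B₁ B₂} → A₂ ⊆ A₁ → B₁ ⊆ B₂ →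
    w A₁ ≡ w B₁ → w A₂ ≡ w B₂ → w (A₁ ─ A₂) + w (B₂ ─ B₁) ≡ 0
  nested-balanced⇒weightOf─≡0 {A₁} {A₂} {B₁} {B₂} A₂⊆A₁ B₁⊆B₂ wA₁≡wB₁ wA₂≡wB₂ =
    trans (+-comm x y) (sym (+-cancelˡ-≡ (w A₁) _ _ (begin
      w A₁ + 0          ≡⟨ +-identityʳ (w A₁) ⟩
      w A₁              ≡⟨ weightOf-⊆ A₂⊆A₁ ⟩
      w A₂ + x          ≡⟨ cong (_+ x) wA₂≡wB₂ ⟩
      w B₂ + x          ≡⟨ cong (_+ x) (weightOf-⊆ B₁⊆B₂) ⟩
      w B₁ + y + x      ≡⟨ cong (λ z → z + y + x) wA₁≡wB₁ ⟨
      w A₁ + y + x      ≡⟨ +-assoc (w A₁) y x ⟩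
      w A₁ + (y + x)    ∎)))
    where
    open ≡-Reasoning
    x = w (A₁ ─ A₂)
    y = w (B₂ ─ B₁)

  nested-balanced⇒∣─∣≡0 : (∀ v → 1 ≤ g v) → ∀ {A₁ A₂ B₁ B₂} → A₂ ⊆ A₁ → B₁ ⊆ B₂ →
    w A₁ ≡ w B₁ → w A₂ ≡ w B₂ → ∣ A₁ ─ A₂ ∣ + ∣ B₂ ─ B₁ ∣ ≡ 0
  nested-balanced⇒∣─∣≡0 pos {A₁} {A₂} {B₁} {B₂} A₂⊆A₁ B₁⊆B₂ wA₁≡wB₁ wA₂≡wB₂ =
    n≤0⇒n≡0 (begin
      ∣ A₁ ─ A₂ ∣ + ∣ B₂ ─ B₁ ∣
        ≤⟨ +-mono-≤ (∣∣≤weightOf g pos (A₁ ─ A₂)) (∣∣≤weightOf g pos (B₂ ─ B₁)) ⟩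
      w (A₁ ─ A₂) + w (B₂ ─ B₁)
        ≡⟨ nested-balanced⇒weightOf─≡0 A₂⊆A₁ B₁⊆B₂ wA₁≡wB₁ wA₂≡wB₂ ⟩
      0 ∎)
    where open ≤-Reasoning

module ConstantWeightChain
  {m : ℕ} (g : Fin m → ℕ) (k : ℕ) (S : ℕ → Subset m) (L : ℕ)
  (constant : ∀ i → weightOf g (S i) ≡ k)
  (apart : ∀ i j → 1 ≤ i → i ≤ L → 1 ≤ j → j ≤ L → 2 ≤ ∣ i - j ∣
             → ¬ ((i ≡ 1 × j ≡ L) ⊎ (i ≡ L × j ≡ 1))
             → Empty (S i ∩ S j))
  (grow : ∀ i → 1 ≤ i → i ≤ L ∸ 2 → (S (i + 1) ─ S i) ⊆ S (i + 2))
  where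

  private
    w : Subset m → ℕ
    w = weightOf g

  gain : ℕ → Subset m
  gain i = S (i + 1) ─ S i

  apart-by-2 : ∀ i → 1 ≤ i → i + 2 ≤ L → 1 < i ⊎ i + 2 < L → Empty (S i ∩ S (i + 2))
  apart-by-2 i 1≤i i+2≤L inner =
    apart i (i + 2) 1≤i (m+n≤o⇒m≤o i i+2≤L) (≤-trans 1≤i (m≤m+n i 2)) i+2≤L
      (≤-reflexive (sym (∣m-m+n∣≡n i 2))) (not-ends inner)
    where
    not-ends : 1 < i ⊎ i + 2 < L → ¬ ((i ≡ 1 × i + 2 ≡ L) ⊎ (i ≡ L × i + 2 ≡ 1))
    not-ends _            (inj₂ (_ , i+2≡1)) with trans (+-comm 2 i) i+2≡1
    ... | ()
    not-ends (inj₁ 1<i)   (inj₁ (i≡1 , _))   = <-irrefl (sym i≡1) 1<i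
    not-ends (inj₂ i+2<L) (inj₁ (_ , i+2≡L)) = <-irrefl i+2≡L i+2<L

  gain-periodic : ∀ i → 1 ≤ i → i + 3 ≤ L → w (gain i) ≡ w (gain (i + 2))
  gain-periodic i 1≤i i+3≤L = weightOf-gain-periodic g
    (grow i 1≤i (m+n≤o⇒m≤o∸n i i+2≤L))
    (apart-by-2 i 1≤i i+2≤L (inj₂ (<-≤-trans (+-monoʳ-< i ≤-refl) i+3≤L)))
    (subst₂ (λ a b → S a ─ S (i + 1) ⊆ S b) (+-assoc i 1 1) (xy∙z≈xz∙y i 1 2)
      (grow (i + 1) (m≤n+m 1 i) (m+n≤o⇒m≤o∸n (i + 1) i+1+2≤L)))
    (subst (λ b → Empty (S (i + 1) ∩ S b)) (xy∙z≈xz∙y i 1 2)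
      (apart-by-2 (i + 1) (m≤n+m 1 i) i+1+2≤L (inj₁ (+-monoˡ-≤ 1 1≤i))))
    (trans (constant (i + 2)) (sym (constant (i + 2 + 1))))
    where
    i+2≤L : i + 2 ≤ L
    i+2≤L = ≤-trans (+-monoʳ-≤ i (n≤1+n 2)) i+3≤L
    i+1+2≤L : i + 1 + 2 ≤ L
    i+1+2≤L = subst (_≤ L) (sym (+-assoc i 1 2)) i+3≤L

  gain-alternates : ∀ i r → 1 ≤ i → i + 2 * r + 1 ≤ L → w (gain i) ≡ w (gain (i + 2 * r))
  gain-alternates i 0       1≤i _       = cong (λ j → w (gain j)) (sym (+-identityʳ i))
  gain-alternates i (suc r) 1≤i bound = begin
    w (gain i)
      ≡⟨ gain-alternates i r 1≤i (≤-trans (+-monoʳ-≤ (i + 2 * r) (s≤s z≤n)) i+2r+3≤L) ⟩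
    w (gain (i + 2 * r))
      ≡⟨ gain-periodic (i + 2 * r) (≤-trans 1≤i (m≤m+n i _)) i+2r+3≤L ⟩
    w (gain (i + 2 * r + 2))
      ≡⟨ cong (λ j → w (gain j)) (shift i r) ⟩
    w (gain (i + 2 * suc r)) ∎
    where
    open ≡-Reasoning
    shift : ∀ i r → i + 2 * r + 2 ≡ i + 2 * suc r
    shift = solve-∀
    i+2r+3≤L : i + 2 * r + 3 ≤ L
    i+2r+3≤L = subst (_≤ L) (trans (cong (_+ 1) (sym (shift i r))) (+-assoc (i + 2 * r) 2 1)) bound

  loss≡gain : ∀ i r → 1 ≤ i → i + 1 + 2 * r ≤ L →
              w (S i ─ S (i + 1)) ≡ w (S (i + 1 + 2 * r) ─ S (i + 2 * r))
  loss≡gain i r 1≤i bound = begin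
    w (S i ─ S (i + 1))
      ≡⟨ weightOf-─-swap g (S i) (S (i + 1)) (trans (constant i) (sym (constant (i + 1)))) ⟩
    w (gain i)
      ≡⟨ gain-alternates i r 1≤i (subst (_≤ L) i+1+2r≡i+2r+1 bound) ⟩
    w (gain (i + 2 * r))
      ≡⟨ cong (λ j → w (S j ─ S (i + 2 * r))) i+1+2r≡i+2r+1 ⟨
    w (S (i + 1 + 2 * r) ─ S (i + 2 * r)) ∎
    where
    open ≡-Reasoning
    i+1+2r≡i+2r+1 : i + 1 + 2 * r ≡ i + 2 * r + 1
    i+1+2r≡i+2r+1 = xy∙z≈xz∙y i 1 (2 * r)

label : ∀ {m} → (Fin m → Fin m) → Fin m → ℕ
label f v = suc (toℕ (f v))

theorem3p5 : (G : Graph) → Type3Chains G → NonDistanceMagic G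
theorem3p5 G T (f , _ , k , constant) with Type3Chains.condII T
... | i , j , r , 1≤i , _ , 1≤j , _ , _ , bound₁ , bound₂ , A₂⊆A₁ , B₁⊆B₂ , strict =
  1+n≰n (subst (1 ≤_) (nested-balanced⇒∣─∣≡0 (label f) (λ _ → s≤s z≤n) A₂⊆A₁ B₁⊆B₂
    (NC₁.loss≡gain i r 1≤i bound₁) (NC₂.loss≡gain j r 1≤j bound₂)) strict)
  where
  open Type3Chains T
  module NC₁ = ConstantWeightChain (label f) k (N G ∘ u₁) n₁ (constant ∘ u₁)
                 (proj₂ (proj₂ chain₁)) (proj₁ condI₁)
  module NC₂ = ConstantWeightChain (label f) k (N G ∘ u₂) n₂ (constant ∘ u₂)
                 (proj₂ (proj₂ chain₂)) (proj₁ condI₂)
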